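{- Let $A=(a_n)_{n\ge0}$ be a sequence of real numbers, let $t\ge 0$, and let $R=(r_{n,k})_{n,k\ge0}$ be the Riordan array with $A$-sequence $A$ and $Z$-sequence either $Z=(ta_0,ta_1,ta_2,\ldots)$ or $Z=(ta_0+a_1,a_2,a_3,\ldots)$. If $A$ is a Pólya frequency sequence, then $R$ is totally positive. In particular, every consistent Riordan array (one whose $Z$-sequence equals $(a_0,a_1,a_2,\ldots)$) and every quasi-consistent Riordan array (one whose $Z$-sequence equals $(a_1,a_2,a_3,\ldots)$) with a Pólya frequency $A$-sequence is totally positive.
   Context: Given sequences $A=(a_n)_{n\ge0}$ and $Z=(z_n)_{n\ge0}$, the Riordan array with $A$-sequence $A$ and $Z$-sequence $Z$ is the infinite lower-triangular matrix $R=(r_{n,k})_{n,k\ge0}$ determined by $r_{0,0}=1$, $r_{0,k}=0$ for $k>0$, and the recurrences $r_{n+1,0}=\sum_{i\ge0} z_i r_{n,i}$ and $r_{n+1,k+1}=\sum_{i\ge0}a_i r_{n,k+i}$. A matrix is totally positive if all its minors are non-negative. A sequence $(a_n)_{n\ge0}$ is a Pólya frequency sequence if its Toeplitz matrix $(a_{i-j})_{i,j\ge0}$ (with $a_m=0$ for $m<0$) is totally positive. -}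

module Defs where

open import Level using (Level; _⊔_) renaming (suc to lsuc)
open import Algebra.Bundles using (CommutativeRing)
open import Relation.Binary.Core using (Rel)
open import Relation.Binary.Structures using (IsTotalOrder)
open import Data.Nat as ℕ using (ℕ; zero; suc; _∸_)
open import Data.Fin as Fin using (Fin; zero; suc; toℕ; punchIn)
open import Data.Bool using (if_then_else_)
open import Relation.Nullary.Decidable using (⌊_⌋)

-- A (totally) ordered commutative ring; the real numbers are the
-- intended model.  The theorem is stated for every such ring.
record OrderedCommutativeRing (c ℓ₁ ℓ₂ : Level) : Set (lsuc (c ⊔ ℓ₁ ⊔ ℓ₂)) where
  field
    commutativeRing : CommutativeRing c ℓ₁
  open CommutativeRing commutativeRing public
  field
    _≤_          : Rel Carrier ℓ₂
    isTotalOrder : IsTotalOrder _≈_ _≤_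
    +-monoˡ-≤    : ∀ {x y} z → x ≤ y → (x + z) ≤ (y + z)
    *-nonneg     : ∀ {x y} → 0# ≤ x → 0# ≤ y → 0# ≤ (x * y)

module _ {c ℓ₁ ℓ₂} (R : OrderedCommutativeRing c ℓ₁ ℓ₂) where
  open OrderedCommutativeRing R using (Carrier; _+_; _*_; -_; 0#; 1#; _≤_)

  sumFin : ∀ n → (Fin n → Carrier) → Carrier
  sumFin zero    f = 0#
  sumFin (suc n) f = f zero + sumFin n (λ i → f (suc i))

  sumUpTo : ℕ → (ℕ → Carrier) → Carrier
  sumUpTo zero    f = f 0
  sumUpTo (suc n) f = sumUpTo n f + f (suc n)

  sign : ℕ → Carrier
  sign zero    = 1#
  sign (suc k) = - sign k

  det : ∀ n → (Fin n → Fin n → Carrier) → Carrier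
  det zero    M = 1#
  det (suc n) M =
    sumFin (suc n) (λ j → sign (toℕ j) * (M zero j * det n (λ i k → M (suc i) (punchIn j k))))

  StrictlyIncreasing : ∀ {k} → (Fin k → ℕ) → Set
  StrictlyIncreasing {k} f = ∀ (i j : Fin k) → i Fin.< j → f i ℕ.< f j

  TotallyPositive : (ℕ → ℕ → Carrier) → Set (ℓ₂)
  TotallyPositive M =
    ∀ (k : ℕ) (rows cols : Fin k → ℕ) →
    StrictlyIncreasing rows → StrictlyIncreasing cols →
    0# ≤ det k (λ i j → M (rows i) (cols j))

  toeplitz : (ℕ → Carrier) → ℕ → ℕ → Carrier
  toeplitz a i j = if ⌊ j ℕ.≤? i ⌋ then a (i ∸ j) else 0#

  PolyaFrequency : (ℕ → Carrier) → Set ℓ₂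
  PolyaFrequency a = TotallyPositive (toeplitz a)

  -- Riordan array with A-sequence a and Z-sequence z:
  --   r 0 0 = 1, r 0 (k+1) = 0,
  --   r (n+1) 0     = Σ_i z_i r n i,
  --   r (n+1) (k+1) = Σ_i a_i r n (k+i).
  -- Since r n j = 0 for j > n, the infinite sums reduce to i = 0..n.
  riordan : (a z : ℕ → Carrier) → ℕ → ℕ → Carrier
  riordan a z zero    zero    = 1#
  riordan a z zero    (suc k) = 0#
  riordan a z (suc n) zero    = sumUpTo n (λ i → z i * riordan a z n i)
  riordan a z (suc n) (suc k) = sumUpTo n (λ i → a i * riordan a z n (k ℕ.+ i))

  zSeq₁ : Carrier → (ℕ → Carrier) → ℕ → Carrier
  zSeq₁ t a n = t * a n

  zSeq₂ : Carrier → (ℕ → Carrier) → ℕ → Carrier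
  zSeq₂ t a zero    = t * a 0 + a 1
  zSeq₂ t a (suc n) = a (suc (suc n))

-- A Riordan array R satisfies  row (n+1) of R = (row n of R) · P  for its production matrix P,
-- whose column 0 is the Z-sequence and whose column j+1 is column j of the Toeplitz matrix T
-- of the A-sequence.  By Cauchy–Binet a minor of R on rows ≥ 1 is a sum of products of minors
-- of R on lower rows and minors of P, and row 0 of R is (1, 0, 0, …); so by induction on the
-- largest row, R is totally positive as soon as P is.  For Z = t A, column 0 of P is t times
-- column 0 of T and the other columns are those of T; for Z = (t a₀ + a₁, a₂, …), P is T without
-- its row 0, plus t a₀ in the corner.  In both cases multilinearity writes each minor of P as a
-- nonnegative combination of minors of T.
module Submission where

open import Defs
open import Level using (Level)
open import Data.Nat using (ℕ)
open import Data.Product using (_×_; _,_)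

open import Algebra.Bundles using (CommutativeRing)
open import Data.Fin as Fin using (Fin; toℕ; punchIn)
open import Data.List using (List; []; _∷_; _++_; _∷ʳ_; length; map; tabulate; lookup)
open import Data.List.Extrema.Nat using (max; xs≤max)
open import Data.List.Membership.Propositional.Properties using (∈-lookup)
open import Data.List.Properties
  using (++-assoc; ++-identityʳ; length-++; length-map; length-tabulate; tabulate-lookup)
open import Data.List.Relation.Unary.All as All using (All; []; _∷_)
import Data.List.Relation.Unary.All.Properties as All
open import Data.List.Relation.Unary.AllPairs as AllPairs using (AllPairs; []; _∷_)
import Data.List.Relation.Unary.AllPairs.Properties as AllPairs
open import Data.Nat as ℕ using (zero; suc; pred; _<_; _∸_; z≤n; s≤s; z<s; >-nonZero)
import Data.Nat.Properties as ℕ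
open import Data.Sum using (inj₁; inj₂)
open import Function using (_∘_; flip)
open import Relation.Binary.PropositionalEquality as ≡ using (_≡_)
open import Relation.Binary.Structures using (IsTotalOrder)
open import Relation.Nullary using (yes; no; contradiction)

Increasing : List ℕ → Set
Increasing = AllPairs _<_

pred-increasing : ∀ {xs} → Increasing xs → All (0 <_) xs → Increasing (map pred xs)
pred-increasing []             []           = []
pred-increasing (x<xs ∷ xs↑) (0<x ∷ 0<xs) =
  All.map⁺ (All.map (ℕ.pred-mono-< ⦃ >-nonZero 0<x ⦄) x<xs) ∷ pred-increasing xs↑ 0<xs

suc-increasing : ∀ {xs} → Increasing xs → Increasing (map suc xs)
suc-increasing xs↑ = AllPairs.map⁺ (AllPairs.map s≤s xs↑)

increasing-∷ʳ : ∀ {xs N} → Increasing xs → All (_< N) xs → Increasing (xs ∷ʳ N)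
increasing-∷ʳ xs↑ xs<N = AllPairs.++⁺ xs↑ ([] ∷ []) (All.map (_∷ []) xs<N)

increasing-suc⇒positive : ∀ {x xs} → Increasing (suc x ∷ xs) → All (0 <_) (suc x ∷ xs)
increasing-suc⇒positive (x<xs ∷ _) = z<s ∷ All.map (ℕ.<-trans z<s) x<xs

length-∷ʳ : ∀ (xs : List ℕ) x → length (xs ∷ʳ x) ≡ suc (length xs)
length-∷ʳ xs x = ≡.trans (length-++ xs) (ℕ.+-comm (length xs) 1)

lookup-increasing : ∀ {xs} → Increasing xs → ∀ {i j} → i Fin.< j → lookup xs i < lookup xs j
lookup-increasing (x<xs ∷ _)   {Fin.zero}  {Fin.suc j} _         = All.lookup x<xs (∈-lookup j)
lookup-increasing (_ ∷ xs↑)    {Fin.suc i} {Fin.suc j} (s≤s i<j) = lookup-increasing xs↑ i<j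

module Minors {c ℓ} (R : CommutativeRing c ℓ) where
  open CommutativeRing R hiding (zero)
  open import Algebra.Properties.Ring ring using (-‿distribˡ-*; -‿distribʳ-*; -1*x≈-x)
  open import Algebra.Properties.AbelianGroup +-abelianGroup
    using (⁻¹-∙-comm; ε⁻¹≈ε; ⁻¹-involutive)
  open import Algebra.Properties.CommutativeSemigroup +-commutativeSemigroup
    using () renaming (interchange to +-interchange; x∙yz≈y∙xz to +-leftComm)
  open import Algebra.Properties.CommutativeSemigroup *-commutativeSemigroup
    using () renaming (x∙yz≈y∙xz to *-leftComm)
  open import Relation.Binary.Reasoning.Setoid setoid

  -‿distrib-+ : ∀ x y → - (x + y) ≈ - x + - y
  -‿distrib-+ x y = sym (⁻¹-∙-comm x y)

  x-0≈x : ∀ x → x - 0# ≈ x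
  x-0≈x x = trans (+-congˡ ε⁻¹≈ε) (+-identityʳ x)

  -‿interchange : ∀ a b c d → (a + b) - (c + d) ≈ (a - c) + (b - d)
  -‿interchange a b c d = trans (+-congˡ (-‿distrib-+ c d)) (+-interchange a b (- c) (- d))

  *-distribˡ-- : ∀ a u v → a * (u - v) ≈ a * u - a * v
  *-distribˡ-- a u v = trans (distribˡ a u (- v)) (+-congˡ (sym (-‿distribʳ-* a v)))

  infix 8 -1^_
  -1^_ : ℕ → Carrier
  -1^ zero  = 1#
  -1^ suc k = - (-1^ k)

  -- laplace β f (c₀ ∷ … ∷ cₖ) = Σᵢ (-1)ⁱ β cᵢ · f (the list without cᵢ): expansion along a
  -- row β whose complementary minors are given by f.
  laplace : (ℕ → Carrier) → (List ℕ → Carrier) → List ℕ → Carrier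
  laplace β f []       = 0#
  laplace β f (x ∷ xs) = β x * f xs - laplace β (f ∘ (x ∷_)) xs

  -- Rows and columns are given as lists; only equal lengths give a genuine minor.
  minor : (ℕ → ℕ → Carrier) → List ℕ → List ℕ → Carrier
  minor M []       cs = 1#
  minor M (r ∷ rs) cs = laplace (M r) (minor M rs) cs

  laplace-congˡ : ∀ {β γ} f xs → (∀ x → β x ≈ γ x) → laplace β f xs ≈ laplace γ f xs
  laplace-congˡ f []       e = refl
  laplace-congˡ f (x ∷ xs) e = +-cong (*-congʳ (e x)) (-‿cong (laplace-congˡ _ xs e))

  laplace-congʳ-length : ∀ {β f g} xs → (∀ l → suc (length l) ≡ length xs → f l ≈ g l) →
                         laplace β f xs ≈ laplace β g xs
  laplace-congʳ-length []       e = refl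
  laplace-congʳ-length (x ∷ xs) e =
    +-cong (*-congˡ (e xs ≡.refl)) (-‿cong (laplace-congʳ-length xs (λ l eq → e (x ∷ l) (≡.cong suc eq))))

  laplace-congʳ : ∀ {β f g} xs → (∀ l → f l ≈ g l) → laplace β f xs ≈ laplace β g xs
  laplace-congʳ xs e = laplace-congʳ-length xs (λ l _ → e l)

  laplace-+ʳ : ∀ β f g xs → laplace β (λ l → f l + g l) xs ≈ laplace β f xs + laplace β g xs
  laplace-+ʳ β f g []       = sym (+-identityʳ 0#)
  laplace-+ʳ β f g (x ∷ xs) = begin
    β x * (f xs + g xs) - laplace β (λ l → f (x ∷ l) + g (x ∷ l)) xs
      ≈⟨ +-cong (distribˡ (β x) (f xs) (g xs)) (-‿cong (laplace-+ʳ β _ _ xs)) ⟩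
    (β x * f xs + β x * g xs) - (laplace β (f ∘ (x ∷_)) xs + laplace β (g ∘ (x ∷_)) xs)
      ≈⟨ -‿interchange _ _ _ _ ⟩
    laplace β f (x ∷ xs) + laplace β g (x ∷ xs) ∎

  laplace-*ʳ : ∀ β a f xs → laplace β (λ l → a * f l) xs ≈ a * laplace β f xs
  laplace-*ʳ β a f []       = sym (zeroʳ a)
  laplace-*ʳ β a f (x ∷ xs) = begin
    β x * (a * f xs) - laplace β (λ l → a * f (x ∷ l)) xs
      ≈⟨ +-cong (*-leftComm (β x) a (f xs)) (-‿cong (laplace-*ʳ β a _ xs)) ⟩
    a * (β x * f xs) - a * laplace β (f ∘ (x ∷_)) xs
      ≈⟨ *-distribˡ-- a _ _ ⟨
    a * laplace β f (x ∷ xs) ∎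

  laplace-0ʳ : ∀ β xs → laplace β (λ _ → 0#) xs ≈ 0#
  laplace-0ʳ β xs = begin
    laplace β (λ _ → 0#) xs       ≈⟨ laplace-congʳ xs (λ _ → zeroˡ 0#) ⟨
    laplace β (λ _ → 0# * 0#) xs  ≈⟨ laplace-*ʳ β 0# (λ _ → 0#) xs ⟩
    0# * laplace β (λ _ → 0#) xs  ≈⟨ zeroˡ _ ⟩
    0#                            ∎

  laplace--ʳ : ∀ β f g xs → laplace β (λ l → f l - g l) xs ≈ laplace β f xs - laplace β g xs
  laplace--ʳ β f g xs = begin
    laplace β (λ l → f l - g l) xs             ≈⟨ laplace-congʳ xs (λ l → +-congˡ (-1*x≈-x (g l))) ⟨
    laplace β (λ l → f l + - 1# * g l) xs      ≈⟨ laplace-+ʳ β f _ xs ⟩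
    laplace β f xs + laplace β (λ l → - 1# * g l) xs ≈⟨ +-congˡ (laplace-*ʳ β (- 1#) g xs) ⟩
    laplace β f xs + - 1# * laplace β g xs     ≈⟨ +-congˡ (-1*x≈-x _) ⟩
    laplace β f xs - laplace β g xs            ∎

  laplace-+ˡ : ∀ β γ f xs → laplace (λ x → β x + γ x) f xs ≈ laplace β f xs + laplace γ f xs
  laplace-+ˡ β γ f []       = sym (+-identityʳ 0#)
  laplace-+ˡ β γ f (x ∷ xs) = begin
    (β x + γ x) * f xs - laplace (λ x → β x + γ x) (f ∘ (x ∷_)) xs
      ≈⟨ +-cong (distribʳ (f xs) (β x) (γ x)) (-‿cong (laplace-+ˡ β γ _ xs)) ⟩
    (β x * f xs + γ x * f xs) - (laplace β (f ∘ (x ∷_)) xs + laplace γ (f ∘ (x ∷_)) xs)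
      ≈⟨ -‿interchange _ _ _ _ ⟩
    laplace β f (x ∷ xs) + laplace γ f (x ∷ xs) ∎

  laplace-*ˡ : ∀ a β f xs → laplace (λ x → a * β x) f xs ≈ a * laplace β f xs
  laplace-*ˡ a β f []       = sym (zeroʳ a)
  laplace-*ˡ a β f (x ∷ xs) = begin
    a * β x * f xs - laplace (λ x → a * β x) (f ∘ (x ∷_)) xs
      ≈⟨ +-cong (*-assoc a (β x) (f xs)) (-‿cong (laplace-*ˡ a β _ xs)) ⟩
    a * (β x * f xs) - a * laplace β (f ∘ (x ∷_)) xs
      ≈⟨ *-distribˡ-- a _ _ ⟨
    a * laplace β f (x ∷ xs) ∎

  laplace-vanishingˡ : ∀ {β} f xs → All (λ x → β x ≈ 0#) xs → laplace β f xs ≈ 0#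
  laplace-vanishingˡ f []       []       = refl
  laplace-vanishingˡ f (x ∷ xs) (e ∷ es) = begin
    _ * f xs - laplace _ (f ∘ (x ∷_)) xs  ≈⟨ +-cong (*-congʳ e) (-‿cong (laplace-vanishingˡ _ xs es)) ⟩
    0# * f xs - 0#                        ≈⟨ x-0≈x _ ⟩
    0# * f xs                             ≈⟨ zeroˡ _ ⟩
    0#                                    ∎

  laplace-swap : ∀ α β f xs → laplace α (laplace β f) xs ≈ - laplace β (laplace α f) xs
  laplace-swap α β f []       = sym ε⁻¹≈ε
  laplace-swap α β f (x ∷ xs) = begin
    α x * laplace β f xs - laplace α (λ l → β x * f l - laplace β (f ∘ (x ∷_)) l) xs
      ≈⟨ +-congˡ (-‿cong (laplace--ʳ α _ _ xs)) ⟩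
    α x * laplace β f xs - (laplace α (λ l → β x * f l) xs - laplace α (laplace β (f ∘ (x ∷_))) xs)
      ≈⟨ +-congˡ (-‿cong (+-congʳ (laplace-*ʳ α (β x) f xs))) ⟩
    α x * laplace β f xs - (β x * laplace α f xs - laplace α (laplace β (f ∘ (x ∷_))) xs)
      ≈⟨ exchange (laplace-swap α β (f ∘ (x ∷_)) xs) ⟩
    - (β x * laplace α f xs - (α x * laplace β f xs - laplace β (laplace α (f ∘ (x ∷_))) xs))
      ≈⟨ -‿cong (+-congˡ (-‿cong (+-congʳ (laplace-*ʳ β (α x) f xs)))) ⟨
    - (β x * laplace α f xs - (laplace β (λ l → α x * f l) xs - laplace β (laplace α (f ∘ (x ∷_))) xs))
      ≈⟨ -‿cong (+-congˡ (-‿cong (laplace--ʳ β _ _ xs))) ⟨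
    - laplace β (laplace α f) (x ∷ xs) ∎
    where
    exchange : ∀ {A B X Y} → X ≈ - Y → A - (B - X) ≈ - (B - (A - Y))
    exchange {A} {B} {X} {Y} X≈-Y = begin
      A + - (B + - X)      ≈⟨ +-congˡ (-‿distrib-+ B (- X)) ⟩
      A + (- B + - - X)    ≈⟨ +-congˡ (+-congˡ (trans (⁻¹-involutive X) X≈-Y)) ⟩
      A + (- B + - Y)      ≈⟨ +-leftComm A (- B) (- Y) ⟩
      - B + (A + - Y)      ≈⟨ +-congˡ (⁻¹-involutive _) ⟨
      - B + - - (A + - Y)  ≈⟨ -‿distrib-+ B _ ⟨
      - (B + - (A + - Y))  ∎

  laplace-self : ∀ α f xs → laplace α (laplace α f) xs ≈ 0#
  laplace-self α f []       = refl
  laplace-self α f (x ∷ xs) = begin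
    α x * laplace α f xs - laplace α (λ l → α x * f l - laplace α (f ∘ (x ∷_)) l) xs
      ≈⟨ +-congˡ (-‿cong (laplace--ʳ α _ _ xs)) ⟩
    α x * laplace α f xs - (laplace α (λ l → α x * f l) xs - laplace α (laplace α (f ∘ (x ∷_))) xs)
      ≈⟨ +-congˡ (-‿cong (+-cong (laplace-*ʳ α (α x) f xs) (-‿cong (laplace-self α _ xs)))) ⟩
    α x * laplace α f xs - (α x * laplace α f xs - 0#)
      ≈⟨ +-congˡ (-‿cong (x-0≈x _)) ⟩
    α x * laplace α f xs - α x * laplace α f xs
      ≈⟨ -‿inverseʳ _ ⟩
    0# ∎

  laplace-comm : ∀ α γ (H : List ℕ → List ℕ → Carrier) xs ys →
    laplace α (λ l → laplace γ (λ l′ → H l′ l) xs) ys ≈ laplace γ (λ l′ → laplace α (H l′) ys) xs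
  laplace-comm α γ H []       ys = laplace-0ʳ α ys
  laplace-comm α γ H (x ∷ xs) ys = begin
    laplace α (λ l → γ x * H xs l - laplace γ (λ l′ → H (x ∷ l′) l) xs) ys
      ≈⟨ laplace--ʳ α _ _ ys ⟩
    laplace α (λ l → γ x * H xs l) ys - laplace α (λ l → laplace γ (λ l′ → H (x ∷ l′) l) xs) ys
      ≈⟨ +-cong (laplace-*ʳ α (γ x) (H xs) ys) (-‿cong (laplace-comm α γ (H ∘ (x ∷_)) xs ys)) ⟩
    γ x * laplace α (H xs) ys - laplace γ (λ l′ → laplace α (H (x ∷ l′)) ys) xs ∎

  laplace-∷ʳ : ∀ β f S N →
    laplace β f (S ∷ʳ N) ≈ laplace β (f ∘ (_∷ʳ N)) S + -1^ length S * (β N * f S)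
  laplace-∷ʳ β f []      N = begin
    β N * f [] - 0#          ≈⟨ x-0≈x _ ⟩
    β N * f []               ≈⟨ *-identityˡ _ ⟨
    1# * (β N * f [])        ≈⟨ +-identityˡ _ ⟨
    0# + 1# * (β N * f [])   ∎
  laplace-∷ʳ β f (x ∷ S) N = begin
    β x * f (S ∷ʳ N) - laplace β (f ∘ (x ∷_)) (S ∷ʳ N)
      ≈⟨ +-congˡ (-‿cong (laplace-∷ʳ β (f ∘ (x ∷_)) S N)) ⟩
    β x * f (S ∷ʳ N) - (laplace β (λ l → f (x ∷ l ∷ʳ N)) S + -1^ length S * (β N * f (x ∷ S)))
      ≈⟨ +-congˡ (-‿distrib-+ _ _) ⟩
    β x * f (S ∷ʳ N) + (- laplace β (λ l → f (x ∷ l ∷ʳ N)) S + - (-1^ length S * (β N * f (x ∷ S))))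
      ≈⟨ +-assoc _ _ _ ⟨
    laplace β (f ∘ (_∷ʳ N)) (x ∷ S) + - (-1^ length S * (β N * f (x ∷ S)))
      ≈⟨ +-congˡ (-‿distribˡ-* _ _) ⟩
    laplace β (f ∘ (_∷ʳ N)) (x ∷ S) + -1^ length (x ∷ S) * (β N * f (x ∷ S)) ∎

  minor-move : ∀ M x T W cs → minor M (x ∷ T ++ W) cs ≈ -1^ length T * minor M (T ++ x ∷ W) cs
  minor-move M x []      W cs = sym (*-identityˡ _)
  minor-move M x (t ∷ T) W cs = begin
    minor M (x ∷ t ∷ T ++ W) cs
      ≈⟨ laplace-swap (M x) (M t) (minor M (T ++ W)) cs ⟩
    - minor M (t ∷ x ∷ T ++ W) cs
      ≈⟨ -‿cong (laplace-congʳ cs (minor-move M x T W)) ⟩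
    - laplace (M t) (λ l → -1^ length T * minor M (T ++ x ∷ W) l) cs
      ≈⟨ -‿cong (laplace-*ʳ (M t) _ _ cs) ⟩
    - (-1^ length T * minor M (t ∷ T ++ x ∷ W) cs)
      ≈⟨ -‿distribˡ-* _ _ ⟩
    -1^ length (t ∷ T) * minor M ((t ∷ T) ++ x ∷ W) cs ∎

  minor-adjacent : ∀ M x T W cs → minor M (T ++ x ∷ x ∷ W) cs ≈ 0#
  minor-adjacent M x []      W cs = laplace-self (M x) (minor M W) cs
  minor-adjacent M x (t ∷ T) W cs =
    trans (laplace-congʳ cs (minor-adjacent M x T W)) (laplace-0ʳ (M t) cs)

  record Alternating (Ψ : List ℕ → Carrier) : Set ℓ where
    field
      repeated : ∀ x T W → Ψ (x ∷ T ++ x ∷ W) ≈ 0#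
      move     : ∀ x T W → Ψ (x ∷ T ++ W) ≈ -1^ length T * Ψ (T ++ x ∷ W)

  minor-alternating : ∀ M cs → Alternating (λ rs → minor M rs cs)
  minor-alternating M cs = record
    { repeated = λ x T W → begin
        minor M (x ∷ T ++ x ∷ W) cs               ≈⟨ minor-move M x T (x ∷ W) cs ⟩
        -1^ length T * minor M (T ++ x ∷ x ∷ W) cs ≈⟨ *-congˡ (minor-adjacent M x T W cs) ⟩
        -1^ length T * 0#                          ≈⟨ zeroʳ _ ⟩
        0#                                         ∎
    ; move = λ x T W → minor-move M x T W cs
    }

  alternating-∷ʳ : ∀ {Ψ} N → Alternating Ψ → Alternating (Ψ ∘ (_∷ʳ N))
  alternating-∷ʳ {Ψ} N alt = record
    { repeated = λ x T W →
        trans (reflexive (≡.cong (Ψ ∘ (x ∷_)) (++-assoc T (x ∷ W) _))) (repeated x T (W ∷ʳ N))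
    ; move = λ x T W →
        trans (reflexive (≡.cong (Ψ ∘ (x ∷_)) (++-assoc T W _)))
          (trans (move x T (W ∷ʳ N))
                 (*-congˡ (reflexive (≡.cong Ψ (≡.sym (++-assoc T (x ∷ W) _))))))
    }
    where open Alternating alt

  sumBelow : ℕ → (ℕ → Carrier) → Carrier
  sumBelow zero    g = 0#
  sumBelow (suc N) g = sumBelow N g + g N

  -- Sum of F S over the k-element subsets S of {0, …, N-1}, each listed increasingly.
  sumSubsets : ℕ → ℕ → (List ℕ → Carrier) → Carrier
  sumSubsets zero    N       F = F []
  sumSubsets (suc k) zero    F = 0#
  sumSubsets (suc k) (suc N) F = sumSubsets (suc k) N F + sumSubsets k N (F ∘ (_∷ʳ N))

  sumBelow-cong : ∀ N {g h} → (∀ m → g m ≈ h m) → sumBelow N g ≈ sumBelow N h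
  sumBelow-cong zero    e = refl
  sumBelow-cong (suc N) e = +-cong (sumBelow-cong N e) (e N)

  sumBelow-+ : ∀ N g h → sumBelow N (λ m → g m + h m) ≈ sumBelow N g + sumBelow N h
  sumBelow-+ zero    g h = sym (+-identityʳ 0#)
  sumBelow-+ (suc N) g h = trans (+-congʳ (sumBelow-+ N g h)) (+-interchange _ _ _ _)

  sumBelow-vanishing : ∀ N g → (∀ m → m < N → g m ≈ 0#) → sumBelow N g ≈ 0#
  sumBelow-vanishing zero    g e = refl
  sumBelow-vanishing (suc N) g e =
    trans (+-cong (sumBelow-vanishing N g (λ m m<N → e m (ℕ.m<n⇒m<1+n m<N))) (e N (ℕ.n<1+n N)))
          (+-identityʳ 0#)

  sumBelow-split : ∀ k L g → sumBelow (k ℕ.+ L) g ≈ sumBelow k g + sumBelow L (g ∘ (k ℕ.+_))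
  sumBelow-split k zero    g rewrite ℕ.+-identityʳ k = sym (+-identityʳ _)
  sumBelow-split k (suc L) g rewrite ℕ.+-suc k L = trans (+-congʳ (sumBelow-split k L g)) (+-assoc _ _ _)

  sumBelow-truncate : ∀ n N g → n ℕ.≤ N → (∀ m → n ℕ.≤ m → g m ≈ 0#) →
                      sumBelow N g ≈ sumBelow n g
  sumBelow-truncate n N g n≤N e = begin
    sumBelow N g
      ≡⟨ ≡.cong (λ L → sumBelow L g) (≡.sym (ℕ.m+[n∸m]≡n n≤N)) ⟩
    sumBelow (n ℕ.+ (N ∸ n)) g
      ≈⟨ sumBelow-split n (N ∸ n) g ⟩
    sumBelow n g + sumBelow (N ∸ n) (g ∘ (n ℕ.+_))
      ≈⟨ +-congˡ (sumBelow-vanishing (N ∸ n) _ (λ m _ → e (n ℕ.+ m) (ℕ.m≤m+n n m))) ⟩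
    sumBelow n g + 0#
      ≈⟨ +-identityʳ _ ⟩
    sumBelow n g ∎

  sumSubsets-cong : ∀ k N {F G} → (∀ S → F S ≈ G S) → sumSubsets k N F ≈ sumSubsets k N G
  sumSubsets-cong zero    N       e = e []
  sumSubsets-cong (suc k) zero    e = refl
  sumSubsets-cong (suc k) (suc N) e =
    +-cong (sumSubsets-cong (suc k) N e) (sumSubsets-cong k N (e ∘ (_∷ʳ N)))

  sumSubsets-+ : ∀ k N F G → sumSubsets k N (λ S → F S + G S) ≈ sumSubsets k N F + sumSubsets k N G
  sumSubsets-+ zero    N       F G = refl
  sumSubsets-+ (suc k) zero    F G = sym (+-identityʳ 0#)
  sumSubsets-+ (suc k) (suc N) F G =
    trans (+-cong (sumSubsets-+ (suc k) N F G) (sumSubsets-+ k N _ _)) (+-interchange _ _ _ _)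

  sumSubsets-*ˡ : ∀ k N a F → sumSubsets k N (λ S → a * F S) ≈ a * sumSubsets k N F
  sumSubsets-*ˡ zero    N       a F = refl
  sumSubsets-*ˡ (suc k) zero    a F = sym (zeroʳ a)
  sumSubsets-*ˡ (suc k) (suc N) a F =
    trans (+-cong (sumSubsets-*ˡ (suc k) N a F) (sumSubsets-*ˡ k N a _)) (sym (distribˡ a _ _))

  sumSubsets-0 : ∀ k N F → (∀ S → F S ≈ 0#) → sumSubsets k N F ≈ 0#
  sumSubsets-0 k N F e = begin
    sumSubsets k N F             ≈⟨ sumSubsets-cong k N (λ S → trans (e S) (sym (zeroˡ 0#))) ⟩
    sumSubsets k N (λ _ → 0# * 0#) ≈⟨ sumSubsets-*ˡ k N 0# (λ _ → 0#) ⟩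
    0# * _                       ≈⟨ zeroˡ _ ⟩
    0#                           ∎

  laplace-sumBelowˡ : ∀ N (γ : ℕ → ℕ → Carrier) f xs →
    laplace (λ c → sumBelow N (λ m → γ m c)) f xs ≈ sumBelow N (λ m → laplace (γ m) f xs)
  laplace-sumBelowˡ zero    γ f xs = laplace-vanishingˡ f xs (All.universal (λ _ → refl) xs)
  laplace-sumBelowˡ (suc N) γ f xs =
    trans (laplace-+ˡ _ (γ N) f xs) (+-congʳ (laplace-sumBelowˡ N γ f xs))

  laplace-sumSubsetsʳ : ∀ k N β (H : List ℕ → List ℕ → Carrier) xs →
    laplace β (λ l → sumSubsets k N (λ S → H S l)) xs ≈ sumSubsets k N (λ S → laplace β (H S) xs)
  laplace-sumSubsetsʳ zero    N       β H xs = refl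
  laplace-sumSubsetsʳ (suc k) zero    β H xs = laplace-0ʳ β xs
  laplace-sumSubsetsʳ (suc k) (suc N) β H xs = trans (laplace-+ʳ β _ _ xs)
    (+-cong (laplace-sumSubsetsʳ (suc k) N β H xs) (laplace-sumSubsetsʳ k N β (H ∘ (_∷ʳ N)) xs))

  -- Sorting m ∷ T into a subset S costs a sign and kills the terms with m ∈ T (Ψ is
  -- alternating); grouping the surviving terms by S leaves the Laplace expansion of S along β.
  sumBelow-sumSubsets-laplace : ∀ N k β f Ψ → Alternating Ψ →
    sumBelow N (λ m → sumSubsets k N (λ T → β m * f T * Ψ (m ∷ T)))
      ≈ sumSubsets (suc k) N (λ S → laplace β f S * Ψ S)
  sumBelow-sumSubsets-laplace zero    k       β f Ψ alt = refl
  sumBelow-sumSubsets-laplace (suc N) zero    β f Ψ alt =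
    +-cong (sumBelow-sumSubsets-laplace N zero β f Ψ alt) (*-congʳ (sym (x-0≈x _)))
  sumBelow-sumSubsets-laplace (suc N) (suc k) β f Ψ alt = begin
    sumBelow N (λ m → T∌N m + T∋N m) + (T∌N N + T∋N N)
      ≈⟨ +-congʳ (sumBelow-+ N _ _) ⟩
    (sumBelow N T∌N + sumBelow N T∋N) + (T∌N N + T∋N N)
      ≈⟨ +-cong (+-cong (sumBelow-sumSubsets-laplace N (suc k) β f Ψ alt)
                        (sumBelow-sumSubsets-laplace N k β f′ Ψ′ (alternating-∷ʳ N alt)))
                (+-cong (sumSubsets-cong (suc k) N sorted)
                        (sumSubsets-0 k N _ (λ T → trans (*-congˡ (repeated N T [])) (zeroʳ _)))) ⟩
    (S∌N + S∋N-front) + (S∋N-last + 0#)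
      ≈⟨ +-congˡ (+-identityʳ _) ⟩
    (S∌N + S∋N-front) + S∋N-last
      ≈⟨ +-assoc _ _ _ ⟩
    S∌N + (S∋N-front + S∋N-last)
      ≈⟨ +-congˡ (sumSubsets-+ (suc k) N _ _) ⟨
    S∌N + sumSubsets (suc k) N (λ S → laplace β f′ S * Ψ′ S + -1^ length S * (β N * f S) * Ψ′ S)
      ≈⟨ +-congˡ (sumSubsets-cong (suc k) N (λ S →
           trans (sym (distribʳ _ _ _)) (*-congʳ (sym (laplace-∷ʳ β f S N))))) ⟩
    sumSubsets (suc (suc k)) (suc N) (λ S → laplace β f S * Ψ S) ∎
    where
    open Alternating alt

    f′ Ψ′ : List ℕ → Carrier
    f′ = f ∘ (_∷ʳ N)
    Ψ′ = Ψ ∘ (_∷ʳ N)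

    T∌N T∋N : ℕ → Carrier
    T∌N m = sumSubsets (suc k) N (λ T → β m * f T * Ψ (m ∷ T))
    T∋N m = sumSubsets k N (λ T → β m * f′ T * Ψ′ (m ∷ T))

    S∌N S∋N-front S∋N-last : Carrier
    S∌N       = sumSubsets (suc (suc k)) N (λ S → laplace β f S * Ψ S)
    S∋N-front = sumSubsets (suc k) N (λ S → laplace β f′ S * Ψ′ S)
    S∋N-last  = sumSubsets (suc k) N (λ S → -1^ length S * (β N * f S) * Ψ′ S)

    sorted : ∀ T → β N * f T * Ψ (N ∷ T) ≈ -1^ length T * (β N * f T) * Ψ′ T
    sorted T = begin
      β N * f T * Ψ (N ∷ T)
        ≈⟨ *-congˡ (reflexive (≡.cong (Ψ ∘ (N ∷_)) (≡.sym (++-identityʳ T)))) ⟩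
      β N * f T * Ψ (N ∷ T ++ [])
        ≈⟨ *-congˡ (move N T []) ⟩
      β N * f T * (-1^ length T * Ψ′ T)    ≈⟨ *-assoc _ _ _ ⟨
      β N * f T * -1^ length T * Ψ′ T      ≈⟨ *-congʳ (*-comm _ _) ⟩
      -1^ length T * (β N * f T) * Ψ′ T    ∎

  matMul : ℕ → (ℕ → ℕ → Carrier) → (ℕ → ℕ → Carrier) → ℕ → ℕ → Carrier
  matMul N B C i j = sumBelow N (λ m → B i m * C m j)

  cauchy-binet : ∀ N B C rs cs →
    minor (matMul N B C) rs cs ≈ sumSubsets (length rs) N (λ S → minor B rs S * minor C S cs)
  cauchy-binet N B C []       cs = sym (*-identityˡ 1#)
  cauchy-binet N B C (r ∷ rs) cs = begin
    laplace (matMul N B C r) (minor (matMul N B C) rs) cs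
      ≈⟨ laplace-congʳ cs (cauchy-binet N B C rs) ⟩
    laplace (λ c → sumBelow N (λ m → B r m * C m c)) cofactor cs
      ≈⟨ laplace-sumBelowˡ N (λ m c → B r m * C m c) cofactor cs ⟩
    sumBelow N (λ m → laplace (λ c → B r m * C m c) cofactor cs)
      ≈⟨ sumBelow-cong N expandRow ⟩
    sumBelow N (λ m → sumSubsets k N (λ T → B r m * minor B rs T * minor C (m ∷ T) cs))
      ≈⟨ sumBelow-sumSubsets-laplace N k (B r) (minor B rs) _ (minor-alternating C cs) ⟩
    sumSubsets (suc k) N (λ S → laplace (B r) (minor B rs) S * minor C S cs) ∎
    where
    k : ℕ
    k = length rs

    cofactor : List ℕ → Carrier
    cofactor l = sumSubsets k N (λ T → minor B rs T * minor C T l)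

    expandRow : ∀ m → laplace (λ c → B r m * C m c) cofactor cs
                        ≈ sumSubsets k N (λ T → B r m * minor B rs T * minor C (m ∷ T) cs)
    expandRow m = begin
      laplace (λ c → B r m * C m c) cofactor cs
        ≈⟨ laplace-*ˡ (B r m) (C m) cofactor cs ⟩
      B r m * laplace (C m) cofactor cs
        ≈⟨ *-congˡ (laplace-sumSubsetsʳ k N (C m) (λ T l → minor B rs T * minor C T l) cs) ⟩
      B r m * sumSubsets k N (λ T → laplace (C m) (λ l → minor B rs T * minor C T l) cs)
        ≈⟨ *-congˡ (sumSubsets-cong k N (λ T → laplace-*ʳ (C m) (minor B rs T) (minor C T) cs)) ⟩
      B r m * sumSubsets k N (λ T → minor B rs T * minor C (m ∷ T) cs)
        ≈⟨ sumSubsets-*ˡ k N (B r m) _ ⟨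
      sumSubsets k N (λ T → B r m * (minor B rs T * minor C (m ∷ T) cs))
        ≈⟨ sumSubsets-cong k N (λ T → sym (*-assoc _ _ _)) ⟩
      sumSubsets k N (λ T → B r m * minor B rs T * minor C (m ∷ T) cs) ∎

  minor-expandColumn : ∀ M rs c cs → length rs ≡ suc (length cs) →
    minor M rs (c ∷ cs) ≈ laplace (λ r → M r c) (λ rs′ → minor M rs′ cs) rs
  minor-expandColumn M (r ∷ [])      c []      _  = refl
  minor-expandColumn M (r ∷ r′ ∷ rs) c cs      eq = +-congˡ (-‿cong (begin
    laplace (M r) (λ l → minor M (r′ ∷ rs) (c ∷ l)) cs
      ≈⟨ laplace-congʳ-length cs (λ l eq′ →
           minor-expandColumn M (r′ ∷ rs) c l (≡.trans (ℕ.suc-injective eq) (≡.sym eq′))) ⟩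
    laplace (M r) (λ l → laplace (λ r₁ → M r₁ c) (λ rs′ → minor M rs′ l) (r′ ∷ rs)) cs
      ≈⟨ laplace-comm (M r) (λ r₁ → M r₁ c) (minor M) (r′ ∷ rs) cs ⟩
    laplace (λ r₁ → M r₁ c) (λ rs′ → laplace (M r) (minor M rs′) cs) (r′ ∷ rs) ∎))

  minor-transpose : ∀ M rs cs → length rs ≡ length cs → minor M rs cs ≈ minor (flip M) cs rs
  minor-transpose M []       []       _  = refl
  minor-transpose M (r ∷ rs) (c ∷ cs) eq = begin
    minor M (r ∷ rs) (c ∷ cs)
      ≈⟨ minor-expandColumn M (r ∷ rs) c cs eq ⟩
    laplace (λ r₁ → M r₁ c) (λ rs′ → minor M rs′ cs) (r ∷ rs)
      ≈⟨ laplace-congʳ-length (r ∷ rs) (λ l eq′ →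
           minor-transpose M l cs (ℕ.suc-injective (≡.trans eq′ eq))) ⟩
    minor (flip M) (c ∷ cs) (r ∷ rs) ∎

  minor-reindexRows : ∀ M M′ (f : ℕ → ℕ) rs cs → All (λ r → ∀ j → M r j ≈ M′ (f r) j) rs →
    minor M rs cs ≈ minor M′ (map f rs) cs
  minor-reindexRows M M′ f []       cs []       = refl
  minor-reindexRows M M′ f (r ∷ rs) cs (e ∷ es) =
    trans (laplace-congʳ cs (λ l → minor-reindexRows M M′ f rs l es)) (laplace-congˡ _ cs e)

module TotalPositivity {c ℓ₁ ℓ₂} (R : OrderedCommutativeRing c ℓ₁ ℓ₂) where
  open OrderedCommutativeRing R hiding (zero) renaming (_≤_ to infix 4 _≤_)
  open Minors commutativeRing
  open import Algebra.Properties.Ring ring using (-1*x≈-x; -‿distribˡ-*)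
  open import Algebra.Properties.AbelianGroup +-abelianGroup using (⁻¹-involutive; ε⁻¹≈ε)
  module ≤ = IsTotalOrder isTotalOrder
  open import Relation.Binary.Reasoning.Setoid setoid

  0≤x+y : ∀ {x y} → 0# ≤ x → 0# ≤ y → 0# ≤ x + y
  0≤x+y {x} {y} 0≤x 0≤y = ≤.trans (≤.≤-respʳ-≈ (sym (+-identityˡ y)) 0≤y) (+-monoˡ-≤ y 0≤x)

  -- If 1 ≤ 0 then 0 ≤ -1, and 0 ≤ (-1)(-1) = 1.
  0≤1 : 0# ≤ 1#
  0≤1 with ≤.total 0# 1#
  ... | inj₁ 0≤1 = 0≤1
  ... | inj₂ 1≤0 = ≤.≤-respʳ-≈ (trans (-1*x≈-x (- 1#)) (⁻¹-involutive 1#)) (*-nonneg 0≤-1 0≤-1)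
    where
    0≤-1 : 0# ≤ - 1#
    0≤-1 = ≤.≤-respˡ-≈ (-‿inverseʳ 1#) (≤.≤-respʳ-≈ (+-identityˡ _) (+-monoˡ-≤ (- 1#) 1≤0))

  TotallyPositive′ : (ℕ → ℕ → Carrier) → Set ℓ₂
  TotallyPositive′ M =
    ∀ rs cs → Increasing rs → Increasing cs → length rs ≡ length cs → 0# ≤ minor M rs cs

  sumFin-cong : ∀ n f g → (∀ j → f j ≈ g j) → sumFin R n f ≈ sumFin R n g
  sumFin-cong zero    f g e = refl
  sumFin-cong (suc n) f g e = +-cong (e Fin.zero) (sumFin-cong n _ _ (e ∘ Fin.suc))

  sumFin-neg : ∀ n (s x : Fin n → Carrier) →
               sumFin R n (λ j → - s j * x j) ≈ - sumFin R n (λ j → s j * x j)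
  sumFin-neg zero    s x = sym ε⁻¹≈ε
  sumFin-neg (suc n) s x = begin
    - s Fin.zero * x Fin.zero + sumFin R n (λ j → - s (Fin.suc j) * x (Fin.suc j))
      ≈⟨ +-cong (sym (-‿distribˡ-* _ _)) (sumFin-neg n (s ∘ Fin.suc) (x ∘ Fin.suc)) ⟩
    - (s Fin.zero * x Fin.zero) + - sumFin R n (λ j → s (Fin.suc j) * x (Fin.suc j))
      ≈⟨ -‿distrib-+ _ _ ⟨
    - sumFin R (suc n) (λ j → s j * x j) ∎

  laplace-tabulate : ∀ n β f (g : Fin (suc n) → ℕ) → laplace β f (tabulate g) ≈
    sumFin R (suc n) (λ j → sign R (toℕ j) * (β (g j) * f (tabulate (g ∘ punchIn j))))
  laplace-tabulate zero    β f g = begin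
    β (g Fin.zero) * f [] - 0#         ≈⟨ x-0≈x _ ⟩
    β (g Fin.zero) * f []              ≈⟨ *-identityˡ _ ⟨
    1# * (β (g Fin.zero) * f [])       ≈⟨ +-identityʳ _ ⟨
    1# * (β (g Fin.zero) * f []) + 0#  ∎
  laplace-tabulate (suc n) β f g = +-cong (sym (*-identityˡ _)) (begin
    - laplace β (f ∘ (g Fin.zero ∷_)) (tabulate (g ∘ Fin.suc))
      ≈⟨ -‿cong (laplace-tabulate n β (f ∘ (g Fin.zero ∷_)) (g ∘ Fin.suc)) ⟩
    - sumFin R (suc n) (λ j → sign R (toℕ j) * term j)
      ≈⟨ sumFin-neg (suc n) (sign R ∘ toℕ) term ⟨
    sumFin R (suc n) (λ j → sign R (suc (toℕ j)) * term j) ∎)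
    where
    term : Fin (suc n) → Carrier
    term j = β (g (Fin.suc j)) * f (g Fin.zero ∷ tabulate (g ∘ Fin.suc ∘ punchIn j))

  det≈minor : ∀ M n (f g : Fin n → ℕ) →
              det R n (λ i j → M (f i) (g j)) ≈ minor M (tabulate f) (tabulate g)
  det≈minor M zero    f g = refl
  det≈minor M (suc n) f g = trans
    (sumFin-cong (suc n) term _ (λ j → *-congˡ (*-congˡ (det≈minor M n (f ∘ Fin.suc) (g ∘ punchIn j)))))
    (sym (laplace-tabulate n (M (f Fin.zero)) (minor M (tabulate (f ∘ Fin.suc))) g))
    where
    term : Fin (suc n) → Carrier
    term j = sign R (toℕ j) * (M (f Fin.zero) (g j) * det R n (λ i k → M (f (Fin.suc i)) (g (punchIn j k))))

  TotallyPositive′⇒ : ∀ {M} → TotallyPositive′ M → TotallyPositive R M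
  TotallyPositive′⇒ {M} tp k rows cols rows↑ cols↑ =
    ≤.≤-respʳ-≈ (sym (det≈minor M k rows cols))
      (tp (tabulate rows) (tabulate cols)
          (AllPairs.tabulate⁺-< (rows↑ _ _)) (AllPairs.tabulate⁺-< (cols↑ _ _))
          (≡.trans (length-tabulate rows) (≡.sym (length-tabulate cols))))

  TotallyPositive⇒′ : ∀ {M} → TotallyPositive R M → TotallyPositive′ M
  TotallyPositive⇒′ {M} tp rs cs rs↑ cs↑ |rs|≡|cs| =
    ≡.subst (λ rs → 0# ≤ minor M rs cs) (tabulate-lookup rs)
      (minor-tabulate (lookup rs) |rs|≡|cs| (λ _ _ → lookup-increasing rs↑))
    where
    minor-tabulate : ∀ {k} (rows : Fin k → ℕ) → k ≡ length cs → StrictlyIncreasing R rows →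
                     0# ≤ minor M (tabulate rows) cs
    minor-tabulate rows ≡.refl rows↑ =
      ≡.subst (λ cs → 0# ≤ minor M (tabulate rows) cs) (tabulate-lookup cs)
        (≤.≤-respʳ-≈ (det≈minor M _ rows (lookup cs))
          (tp _ rows (lookup cs) rows↑ (λ _ _ → lookup-increasing cs↑)))

  TotallyPositive′-flip : ∀ {M} → TotallyPositive′ M → TotallyPositive′ (flip M)
  TotallyPositive′-flip {M} tp rs cs rs↑ cs↑ |rs|≡|cs| =
    ≤.≤-respʳ-≈ (minor-transpose M cs rs (≡.sym |rs|≡|cs|)) (tp cs rs cs↑ rs↑ (≡.sym |rs|≡|cs|))

  TotallyPositive′⇒entry-nonneg : ∀ {M} → TotallyPositive′ M → ∀ i j → 0# ≤ M i j
  TotallyPositive′⇒entry-nonneg {M} tp i j =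
    ≤.≤-respʳ-≈ (trans (x-0≈x _) (*-identityʳ _)) (tp (i ∷ []) (j ∷ []) ([] ∷ []) ([] ∷ []) ≡.refl)

  reindexRows-nonneg : ∀ {M N} (f : ℕ → ℕ) → TotallyPositive′ N →
    ∀ rs cs → All (λ r → ∀ j → M r j ≈ N (f r) j) rs → Increasing (map f rs) → Increasing cs →
    length rs ≡ length cs → 0# ≤ minor M rs cs
  reindexRows-nonneg {M} {N} f tp rs cs e frs↑ cs↑ |rs|≡|cs| =
    ≤.≤-respʳ-≈ (sym (minor-reindexRows M N f rs cs e))
      (tp (map f rs) cs frs↑ cs↑ (≡.trans (length-map f rs) |rs|≡|cs|))

  sumSubsets-nonneg : ∀ k N F → (∀ S → Increasing S → All (_< N) S → length S ≡ k → 0# ≤ F S) →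
                      0# ≤ sumSubsets k N F
  sumSubsets-nonneg zero    N       F h = h [] [] [] ≡.refl
  sumSubsets-nonneg (suc k) zero    F h = ≤.refl
  sumSubsets-nonneg (suc k) (suc N) F h = 0≤x+y
    (sumSubsets-nonneg (suc k) N F (λ S S↑ S<N → h S S↑ (All.map ℕ.m<n⇒m<1+n S<N)))
    (sumSubsets-nonneg k N (F ∘ (_∷ʳ N)) (λ T T↑ T<N |T|≡k →
       h (T ∷ʳ N) (increasing-∷ʳ T↑ T<N) (All.++⁺ (All.map ℕ.m<n⇒m<1+n T<N) (ℕ.n<1+n N ∷ []))
         (≡.trans (length-∷ʳ T N) (≡.cong suc |T|≡k))))

  NonnegMinorsBelow : ℕ → (ℕ → ℕ → Carrier) → Set ℓ₂
  NonnegMinorsBelow n M = ∀ rs cs → Increasing rs → All (_< n) rs → Increasing cs →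
                          length rs ≡ length cs → 0# ≤ minor M rs cs

  nonnegMinorsBelow⇒TotallyPositive′ : ∀ {M} → (∀ n → NonnegMinorsBelow n M) → TotallyPositive′ M
  nonnegMinorsBelow⇒TotallyPositive′ below rs cs rs↑ =
    below (suc (max 0 rs)) rs cs rs↑ (All.map s≤s (xs≤max 0 rs))

  matMul-nonneg : ∀ {n N B C} → NonnegMinorsBelow n B → TotallyPositive′ C →
                  NonnegMinorsBelow n (matMul N B C)
  matMul-nonneg {n} {N} {B} {C} B-nonneg C-TP rs cs rs↑ rs<n cs↑ |rs|≡|cs| =
    ≤.≤-respʳ-≈ (sym (cauchy-binet N B C rs cs))
      (sumSubsets-nonneg (length rs) N _ (λ S S↑ _ |S|≡|rs| →
        *-nonneg (B-nonneg rs S rs↑ rs<n S↑ (≡.sym |S|≡|rs|))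
                 (C-TP S cs S↑ cs↑ (≡.trans |S|≡|rs| |rs|≡|cs|))))

  δ₀ : ℕ → Carrier
  δ₀ zero    = 1#
  δ₀ (suc _) = 0#

  δ₀-vanishing : ∀ {xs} → All (0 <_) xs → All (λ x → δ₀ x ≈ 0#) xs
  δ₀-vanishing = All.map λ { {suc _} _ → refl }

  laplace-δ₀-nonneg : ∀ f cs → Increasing cs →
    (∀ cs′ → Increasing cs′ → All (0 <_) cs′ → suc (length cs′) ≡ length cs → 0# ≤ f cs′) →
    0# ≤ laplace δ₀ f cs
  laplace-δ₀-nonneg f []             _             h = ≤.refl
  laplace-δ₀-nonneg f (zero ∷ cs)    (0<cs ∷ cs↑)  h =
    ≤.≤-respʳ-≈ (sym (begin
      1# * f cs - laplace δ₀ (f ∘ (0 ∷_)) cs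
        ≈⟨ +-congˡ (-‿cong (laplace-vanishingˡ _ cs (δ₀-vanishing 0<cs))) ⟩
      1# * f cs - 0#                         ≈⟨ x-0≈x _ ⟩
      1# * f cs                              ≈⟨ *-identityˡ _ ⟩
      f cs                                   ∎))
      (h cs cs↑ 0<cs ≡.refl)
  laplace-δ₀-nonneg f (suc c ∷ cs) cs↑           h =
    ≤.≤-respʳ-≈ (sym (laplace-vanishingˡ f (suc c ∷ cs) (δ₀-vanishing (increasing-suc⇒positive cs↑))))
      ≤.refl

  production-totallyPositive : ∀ M P → (∀ j → M 0 j ≈ δ₀ j) →
    (∀ {n N} → n < N → ∀ j → M (suc n) j ≈ matMul N M P n j) →
    TotallyPositive′ P → TotallyPositive′ M
  production-totallyPositive M P row₀ rowˢ P-TP = nonnegMinorsBelow⇒TotallyPositive′ below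
    where
    positiveRows : ∀ n → NonnegMinorsBelow n M → ∀ rs cs → Increasing rs → All (0 <_) rs →
      All (_< suc n) rs → Increasing cs → length rs ≡ length cs → 0# ≤ minor M rs cs
    positiveRows n ih rs cs rs↑ 0<rs rs≤n cs↑ |rs|≡|cs| =
      ≤.≤-respʳ-≈ (sym (minor-reindexRows M (matMul n M P) pred rs cs (All.zipWith shift (0<rs , rs≤n))))
        (matMul-nonneg {N = n} ih P-TP (map pred rs) cs (pred-increasing rs↑ 0<rs)
          (All.map⁺ (All.zipWith lower (0<rs , rs≤n))) cs↑ (≡.trans (length-map pred rs) |rs|≡|cs|))
      where
      lower : ∀ {r} → 0 < r × r < suc n → pred r < n
      lower {suc r} (_ , s≤s r<n) = r<n

      shift : ∀ {r} → 0 < r × r < suc n → ∀ j → M r j ≈ matMul n M P (pred r) j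
      shift {suc r} (_ , s≤s r<n) = rowˢ r<n

    below : ∀ n → NonnegMinorsBelow n M
    below n       []           cs _            _           _   _ = 0≤1
    below (suc n) (zero ∷ rs)  cs (0<rs ∷ rs↑) (_ ∷ rs≤n)  cs↑ |rs|≡|cs| =
      ≤.≤-respʳ-≈ (sym (laplace-congˡ (minor M rs) cs row₀))
        (laplace-δ₀-nonneg (minor M rs) cs cs↑ (λ cs′ cs′↑ _ eq →
          positiveRows n (below n) rs cs′ rs↑ 0<rs rs≤n cs′↑
            (ℕ.suc-injective (≡.trans |rs|≡|cs| (≡.sym eq)))))
    below (suc n) (suc r ∷ rs) cs rs↑          rs≤n        cs↑ |rs|≡|cs| =
      positiveRows n (below n) (suc r ∷ rs) cs rs↑ (increasing-suc⇒positive rs↑) rs≤n cs↑ |rs|≡|cs|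
    below zero    (_ ∷ _)      _  _            (() ∷ _)    _   _

  prependScaledRow-totallyPositive : ∀ {M N t} → 0# ≤ t → (∀ j → M 0 j ≈ t * N 0 j) →
    (∀ r j → M (suc r) j ≈ N r j) → TotallyPositive′ N → TotallyPositive′ M
  prependScaledRow-totallyPositive {M} {N} {t} 0≤t row₀ rowˢ N-TP = tp
    where
    shiftRows : ∀ {rs} → All (0 <_) rs → All (λ r → ∀ j → M r j ≈ N (pred r) j) rs
    shiftRows = All.map λ { {suc r} _ → rowˢ r }

    shifted : ∀ rs cs → All (0 <_) rs → Increasing rs → Increasing cs → length rs ≡ length cs →
              0# ≤ minor M rs cs
    shifted rs cs 0<rs rs↑ = reindexRows-nonneg pred N-TP rs cs (shiftRows 0<rs) (pred-increasing rs↑ 0<rs)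

    scaled : ∀ rs cs → All (0 <_) rs → minor M (0 ∷ rs) cs ≈ t * minor N (0 ∷ map pred rs) cs
    scaled rs cs 0<rs = begin
      laplace (M 0) (minor M rs) cs
        ≈⟨ laplace-congʳ cs (λ l → minor-reindexRows M N pred rs l (shiftRows 0<rs)) ⟩
      laplace (M 0) (minor N (map pred rs)) cs
        ≈⟨ laplace-congˡ _ cs row₀ ⟩
      laplace (λ j → t * N 0 j) (minor N (map pred rs)) cs
        ≈⟨ laplace-*ˡ t (N 0) _ cs ⟩
      t * minor N (0 ∷ map pred rs) cs ∎

    tp : TotallyPositive′ M
    tp []                       cs _                   _   _ = 0≤1
    tp (suc r ∷ rs)             cs rs↑                 cs↑ |rs|≡|cs| =
      shifted (suc r ∷ rs) cs (increasing-suc⇒positive rs↑) rs↑ cs↑ |rs|≡|cs|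
    tp (zero ∷ [])              cs _                   cs↑ |rs|≡|cs| =
      ≤.≤-respʳ-≈ (sym (scaled [] cs [])) (*-nonneg 0≤t (N-TP (0 ∷ []) cs ([] ∷ []) cs↑ |rs|≡|cs|))
    tp (zero ∷ zero ∷ _)        _  ((() ∷ _) ∷ _)      _   _
    tp (zero ∷ suc zero ∷ rs)   cs (0<rs ∷ _)          _   _ =
      ≤.≤-respʳ-≈ (sym (trans (scaled (1 ∷ rs) cs 0<rs)
                              (trans (*-congˡ (laplace-self (N 0) _ cs)) (zeroʳ t))))
        ≤.refl
    tp (zero ∷ suc (suc r) ∷ rs) cs (0<rs ∷ rs↑)       cs↑ |rs|≡|cs| =
      let pred-rs↑ = pred-increasing rs↑ 0<rs in
      ≤.≤-respʳ-≈ (sym (scaled (suc (suc r) ∷ rs) cs 0<rs))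
        (*-nonneg 0≤t (N-TP (0 ∷ map pred (suc (suc r) ∷ rs)) cs
          (increasing-suc⇒positive pred-rs↑ ∷ pred-rs↑) cs↑
          (≡.trans (≡.cong suc (length-map pred (suc (suc r) ∷ rs))) |rs|≡|cs|)))

  sumUpTo≈sumBelow : ∀ n g → sumUpTo R n g ≈ sumBelow (suc n) g
  sumUpTo≈sumBelow zero    g = sym (+-identityˡ _)
  sumUpTo≈sumBelow (suc n) g = +-congʳ (sumUpTo≈sumBelow n g)

  module Riordan (a : ℕ → Carrier) where
    T : ℕ → ℕ → Carrier
    T = toeplitz R a

    toeplitz-≥ : ∀ {i j} → j ℕ.≤ i → T i j ≡ a (i ∸ j)
    toeplitz-≥ {i} {j} j≤i with j ℕ.≤? i
    ... | yes _   = ≡.refl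
    ... | no  j≰i = contradiction j≤i j≰i

    toeplitz-< : ∀ {i j} → i < j → T i j ≡ 0#
    toeplitz-< {i} {j} i<j with j ℕ.≤? i
    ... | yes j≤i = contradiction j≤i (ℕ.<⇒≱ i<j)
    ... | no  _   = ≡.refl

    toeplitz-suc : ∀ i j → T (suc i) (suc j) ≡ T i j
    toeplitz-suc i j with ℕ.≤-<-connex j i
    ... | inj₁ j≤i = ≡.trans (toeplitz-≥ (s≤s j≤i)) (≡.sym (toeplitz-≥ j≤i))
    ... | inj₂ i<j = ≡.trans (toeplitz-< (s≤s i<j)) (≡.sym (toeplitz-< i<j))

    production : (ℕ → Carrier) → ℕ → ℕ → Carrier
    production z i zero    = z i
    production z i (suc j) = T i j

    module _ (z : ℕ → Carrier) where
      private
        r : ℕ → ℕ → Carrier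
        r = riordan R a z

      riordan-row₀ : ∀ j → r 0 j ≈ δ₀ j
      riordan-row₀ zero    = refl
      riordan-row₀ (suc _) = refl

      riordan-aboveDiagonal : ∀ {n m} → n < m → r n m ≈ 0#
      riordan-aboveDiagonal {zero}  {suc m} _         = refl
      riordan-aboveDiagonal {suc n} {suc k} (s≤s n<k) = trans (sumUpTo≈sumBelow n _)
        (sumBelow-vanishing (suc n) _ (λ i _ →
          trans (*-congˡ (riordan-aboveDiagonal (ℕ.<-≤-trans n<k (ℕ.m≤m+n k i)))) (zeroʳ _)))

      riordan-production : ∀ {n N} → n < N → ∀ j → r (suc n) j ≈ matMul N r (production z) n j
      riordan-production {n} {N} n<N zero = begin
        sumUpTo R n (λ i → z i * r n i)
          ≈⟨ sumUpTo≈sumBelow n _ ⟩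
        sumBelow (suc n) (λ i → z i * r n i)
          ≈⟨ sumBelow-cong (suc n) (λ i → *-comm _ _) ⟩
        sumBelow (suc n) (λ m → r n m * z m)
          ≈⟨ sumBelow-truncate (suc n) N _ n<N (λ m n<m →
               trans (*-congʳ (riordan-aboveDiagonal n<m)) (zeroˡ _)) ⟨
        sumBelow N (λ m → r n m * z m) ∎
      riordan-production {n} {N} n<N (suc k) = begin
        sumUpTo R n (λ i → a i * r n (k ℕ.+ i))
          ≈⟨ sumUpTo≈sumBelow n _ ⟩
        sumBelow (suc n) (λ i → a i * r n (k ℕ.+ i))
          ≈⟨ sumBelow-truncate (suc n) N _ n<N (λ i n<i →
               trans (*-congˡ (riordan-aboveDiagonal (ℕ.<-≤-trans n<i (ℕ.m≤n+m i k)))) (zeroʳ _)) ⟨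
        sumBelow N (λ i → a i * r n (k ℕ.+ i))
          ≈⟨ sumBelow-cong N (λ i → trans (*-comm _ _) (*-congˡ (reflexive (≡.sym (toeplitz-k+i i))))) ⟩
        sumBelow N (g ∘ (k ℕ.+_))
          ≈⟨ +-identityˡ _ ⟨
        0# + sumBelow N (g ∘ (k ℕ.+_))
          ≈⟨ +-congʳ (sumBelow-vanishing k g (λ m m<k →
               trans (*-congˡ (reflexive (toeplitz-< m<k))) (zeroʳ _))) ⟨
        sumBelow k g + sumBelow N (g ∘ (k ℕ.+_))
          ≈⟨ sumBelow-split k N g ⟨
        sumBelow (k ℕ.+ N) g
          ≈⟨ sumBelow-truncate N (k ℕ.+ N) g (ℕ.m≤n+m N k) (λ m N≤m →
               trans (*-congʳ (riordan-aboveDiagonal (ℕ.<-≤-trans n<N N≤m))) (zeroˡ _)) ⟩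
        sumBelow N g ∎
        where
        g : ℕ → Carrier
        g m = r n m * T m k

        toeplitz-k+i : ∀ i → T (k ℕ.+ i) k ≡ a i
        toeplitz-k+i i = ≡.trans (toeplitz-≥ (ℕ.m≤m+n k i)) (≡.cong a (ℕ.m+n∸m≡n k i))

      riordan-totallyPositive : TotallyPositive′ (production z) → TotallyPositive R r
      riordan-totallyPositive P-TP = TotallyPositive′⇒
        (production-totallyPositive r (production z) riordan-row₀ riordan-production P-TP)

    production₁-totallyPositive : ∀ {t} → 0# ≤ t → TotallyPositive′ T →
                                  TotallyPositive′ (production (zSeq₁ R t a))
    production₁-totallyPositive 0≤t T-TP = TotallyPositive′-flip
      (prependScaledRow-totallyPositive 0≤t (λ j → *-congˡ (reflexive (≡.sym (toeplitz-≥ z≤n))))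
        (λ _ _ → refl) (TotallyPositive′-flip T-TP))

    production₂-totallyPositive : ∀ {t} → 0# ≤ t → TotallyPositive′ T →
                                  TotallyPositive′ (production (zSeq₂ R t a))
    production₂-totallyPositive {t} 0≤t T-TP = tp
      where
      P : ℕ → ℕ → Carrier
      P = production (zSeq₂ R t a)

      row₀ : ∀ j → P 0 j ≈ T 1 j + t * a 0 * δ₀ j
      row₀ zero    = trans (+-comm _ _) (+-cong (reflexive (≡.sym (toeplitz-≥ z≤n))) (sym (*-identityʳ _)))
      row₀ (suc j) =
        trans (reflexive (≡.sym (toeplitz-suc 0 j))) (sym (trans (+-congˡ (zeroʳ _)) (+-identityʳ _)))

      rowˢ : ∀ {r} → 0 < r → ∀ j → P r j ≈ T (suc r) j
      rowˢ {suc r} _ zero    = reflexive (≡.sym (toeplitz-≥ z≤n))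
      rowˢ {suc r} _ (suc j) = reflexive (≡.sym (toeplitz-suc (suc r) j))

      shiftRows : ∀ {rs} → All (0 <_) rs → All (λ r → ∀ j → P r j ≈ T (suc r) j) rs
      shiftRows = All.map rowˢ

      tp : TotallyPositive′ P
      tp []           cs _            _   _         = 0≤1
      tp (suc r ∷ rs) cs rs↑          cs↑ |rs|≡|cs| = reindexRows-nonneg suc T-TP (suc r ∷ rs) cs
        (shiftRows (increasing-suc⇒positive rs↑)) (suc-increasing rs↑) cs↑ |rs|≡|cs|
      tp (zero ∷ rs)  cs (0<rs ∷ rs↑) cs↑ |rs|≡|cs| =
        ≤.≤-respʳ-≈ (sym expand) (0≤x+y rowOfT (*-nonneg (*-nonneg 0≤t 0≤a₀) rowδ₀))
        where
        f : List ℕ → Carrier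
        f = minor T (map suc rs)

        expand : minor P (0 ∷ rs) cs ≈ minor T (1 ∷ map suc rs) cs + t * a 0 * laplace δ₀ f cs
        expand = begin
          laplace (P 0) (minor P rs) cs
            ≈⟨ laplace-congʳ cs (λ l → minor-reindexRows P T suc rs l (shiftRows 0<rs)) ⟩
          laplace (P 0) f cs
            ≈⟨ laplace-congˡ f cs row₀ ⟩
          laplace (λ j → T 1 j + t * a 0 * δ₀ j) f cs
            ≈⟨ laplace-+ˡ (T 1) _ f cs ⟩
          laplace (T 1) f cs + laplace (λ j → t * a 0 * δ₀ j) f cs
            ≈⟨ +-congˡ (laplace-*ˡ (t * a 0) δ₀ f cs) ⟩
          minor T (1 ∷ map suc rs) cs + t * a 0 * laplace δ₀ f cs ∎

        0≤a₀ : 0# ≤ a 0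
        0≤a₀ = TotallyPositive′⇒entry-nonneg T-TP 0 0

        rowOfT : 0# ≤ minor T (1 ∷ map suc rs) cs
        rowOfT = T-TP (map suc (0 ∷ rs)) cs (suc-increasing (0<rs ∷ rs↑)) cs↑
          (≡.trans (length-map suc (0 ∷ rs)) |rs|≡|cs|)

        rowδ₀ : 0# ≤ laplace δ₀ f cs
        rowδ₀ = laplace-δ₀-nonneg f cs cs↑ (λ cs′ cs′↑ _ eq →
          T-TP (map suc rs) cs′ (suc-increasing rs↑) cs′↑
            (≡.trans (length-map suc rs) (ℕ.suc-injective (≡.trans |rs|≡|cs| (≡.sym eq)))))

theorem3p3 : ∀ {c ℓ₁ ℓ₂ : Level} (R : OrderedCommutativeRing c ℓ₁ ℓ₂)
    (a : ℕ → OrderedCommutativeRing.Carrier R) (t : OrderedCommutativeRing.Carrier R) →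
    OrderedCommutativeRing._≤_ R (OrderedCommutativeRing.0# R) t →
    PolyaFrequency R a →
    TotallyPositive R (riordan R a (zSeq₁ R t a)) × TotallyPositive R (riordan R a (zSeq₂ R t a))
theorem3p3 R a t 0≤t a-PF =
    riordan-totallyPositive (zSeq₁ R t a) (production₁-totallyPositive 0≤t T-TP)
  , riordan-totallyPositive (zSeq₂ R t a) (production₂-totallyPositive 0≤t T-TP)
  where
  open TotalPositivity R
  open Riordan a

  T-TP : TotallyPositive′ T
  T-TP = TotallyPositive⇒′ a-PF
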